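{- Let $a>1$ be an integer, $p$ a prime, and $M_p^{(a)}=\frac{a^p-1}{a-1}$. If $\gcd(M_p^{(a)},a-1)=1$, then $M_p^{(a)}$ is either prime or an overpseudoprime to base $a$.
   Context: For an integer $m>1$ with $\gcd(m,a)=1$, $h_a(m)$ denotes the multiplicative order of $a$ modulo $m$. The cyclotomic cosets of $a$ modulo $m$ are the orbits of $\{1,2,\ldots,m-1\}$ under $x\mapsto ax\bmod m$; $r_a(m)$ denotes their number. An odd composite number $n$ with $\gcd(n,a)=1$ is called an overpseudoprime to base $a$ if $n=r_a(n)h_a(n)+1$. -}

module Defs where

open import Data.Nat using (ℕ; zero; suc; _+_; _*_; _∸_; _^_; _≤_; _<_)
open import Data.Nat.DivMod using (_/_; _%_)
open import Data.Nat.Properties using (_≟_; _≤?_)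
open import Data.Nat.Primality using (Composite)
open import Data.Nat.Coprimality using (Coprime)
open import Data.Bool using (Bool; true; false; if_then_else_; _∧_)
open import Data.List using (List; []; _∷_; upTo; map)
open import Data.Product using (_×_)
open import Relation.Binary.PropositionalEquality using (_≡_)
open import Relation.Nullary.Decidable using (⌊_⌋)

-- M_p^{(a)} = (a^p - 1)/(a - 1); only meaningful for a > 1 (returns 0 otherwise).
M : ℕ → ℕ → ℕ
M (suc (suc b)) p = (suc (suc b) ^ p ∸ 1) / suc b
M _ _ = 0

findFrom : (ℕ → Bool) → ℕ → ℕ → ℕ
findFrom P s zero = 0
findFrom P s (suc fuel) = if P s then s else findFrom P (suc s) fuel

-- h_a(m): multiplicative order of a modulo m, i.e. least k ≥ 1 with a^k ≡ 1 (mod m).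
-- For m > 1 and gcd(a,m) = 1 this satisfies 1 ≤ h_a(m) ≤ φ(m) < m, so searching
-- k ∈ [1, m] finds it.
ord : ℕ → ℕ → ℕ
ord a m = findFrom (λ k → ⌊ (a ^ k) % suc (m ∸ 1) ≟ 1 % suc (m ∸ 1) ⌋) 1 m

allB : (ℕ → Bool) → List ℕ → Bool
allB P [] = true
allB P (x ∷ xs) = P x ∧ allB P xs

countB : (ℕ → Bool) → List ℕ → ℕ
countB P [] = 0
countB P (x ∷ xs) = if P x then suc (countB P xs) else countB P xs

-- x is the least element of its cyclotomic coset {a^i x mod m : i ≥ 0}
-- (it suffices to take 0 ≤ i < h_a(m), since the orbit is periodic with period h_a(m)).
isCosetMin : ℕ → ℕ → ℕ → Bool
isCosetMin a m x = allB (λ i → ⌊ x ≤? (a ^ i * x) % suc (m ∸ 1) ⌋) (upTo (ord a m))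

-- r_a(m): number of cyclotomic cosets of a modulo m, i.e. number of orbits of
-- {1, …, m-1} under x ↦ a x mod m, counted via their (unique) least elements.
numCosets : ℕ → ℕ → ℕ
numCosets a m = countB (isCosetMin a m) (map suc (upTo (m ∸ 1)))

Overpseudoprime : ℕ → ℕ → Set
Overpseudoprime a n =
  n % 2 ≡ 1 × Composite n × Coprime n a × n ≡ numCosets a n * ord a n + 1

{-# OPTIONS --safe #-}
-- Write a = c + 1 and m = M_p^(a) = 1 + a + ⋯ + a^(p-1), so that a^p = 1 + c m.  If a divisor
-- d of m satisfies a^k ≡ 1 (mod d) with 0 < k < p, then a ≡ 1 (mod d) because gcd(k, p) = 1,
-- so d divides gcd(m, a - 1) = 1.  Hence m is coprime to every a^k - 1 with 0 < k < p, and
-- multiplication by a returns a nonzero residue x to itself after exactly p steps: h_a(m) = p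
-- and every cyclotomic coset of {1, …, m - 1} has p elements, giving m - 1 = r_a(m) h_a(m).
-- Also m is odd, since otherwise a is odd (m is coprime to a) and 2 divides gcd(m, a - 1).
module Submission where

open import Defs
open import Data.Nat using (ℕ; zero; suc; _+_; _*_; _∸_; _^_; _≤_; _<_; z≤n; s≤s; NonZero; >-nonZero; >-nonZero⁻¹; ≢-nonZero; ≢-nonZero⁻¹)
open import Data.Nat.Properties
open import Data.Nat.DivMod using (_%_; _/_; %-distribˡ-*; m%n%n≡m%n; m≡m%n+[m/n]*n; %-remove-+ʳ; m%n<n; m<n⇒m%n≡m; m*n/n≡m)
open import Data.Nat.Divisibility using (_∣_; _∣?_; divides; ∣-refl; ∣⇒≤; ∣1⇒≡1; 0∣⇒≡0; ∣m+n∣m⇒∣n; ∣m⇒∣m*n; ∣n⇒∣m*n; m%n≡0⇒n∣m)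
open import Data.Nat.Coprimality using (Coprime; coprime-Bézout; coprime-divisor; prime⇒coprime)
open import Data.Nat.GCD using (module Bézout)
open import Data.Nat.Primality using (Prime; prime?; prime⇒nonZero; ¬prime⇒composite; ¬prime[0]; ¬prime[1])
open import Data.Nat.Solver using (module +-*-Solver)
open import Data.Bool using (Bool; true; false; T; _∧_)
open import Data.Bool.Properties using (T-∧)
open import Data.Fin using (Fin; zero; suc; toℕ; fromℕ<; punchIn)
open import Data.Fin.Properties using (toℕ-fromℕ<; toℕ-injective; toℕ<n; punchInᵢ≢i)
open import Data.Fin.Permutation using (Permutation; permutation; _⟨$⟩ʳ_)
open import Data.List using (map; upTo; applyUpTo; allFin)
open import Data.List.Membership.Propositional.Properties using (∈-allFin)
open import Data.List.Relation.Unary.All using (lookup)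
open import Data.List.Extrema ≤-totalOrder using (argmin; f[argmin]≤f[xs])
open import Data.Vec.Functional using (removeAt)
open import Data.Product using (_,_; proj₁; proj₂)
open import Data.Sum using (_⊎_; inj₁; inj₂)
open import Data.Empty using (⊥-elim)
open import Data.Unit using (tt)
open import Function using (_∘_; _⇔_; mk⇔; Injective)
open import Function.Bundles using (Equivalence)
open import Relation.Binary using (tri<; tri≈; tri>)
open import Relation.Nullary using (¬_; yes; no; contradiction)
open import Relation.Nullary.Decidable using (⌊_⌋; isYes≗does; toWitness; fromWitness; dec-true; dec-false)
open import Relation.Binary.PropositionalEquality
open import Algebra.Properties.CommutativeMonoid.Sum +-0-commutativeMonoid
  using (sum; sum-syntax; sum-cong-≗; sum-remove; sum-replicate-zero; ∑-comm; ∑-permute)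

indicator : Bool → ℕ
indicator true = 1
indicator false = 0

indicator-T : ∀ {b} → T b → indicator b ≡ 1
indicator-T {true} _ = refl

∑-const : ∀ n {c} {f : Fin n → ℕ} → (∀ i → f i ≡ c) → ∑[ i < n ] f i ≡ n * c
∑-const zero    f≡c = refl
∑-const (suc n) f≡c = cong₂ _+_ (f≡c zero) (∑-const n (f≡c ∘ suc))

sum-indicator-unique : ∀ {n} (b : Fin n → Bool) (i : Fin n) → T (b i) →
  (∀ j → T (b j) → j ≡ i) → ∑[ j < n ] indicator (b j) ≡ 1
sum-indicator-unique {suc n} b i bi unique = begin
  ∑[ j < suc n ] indicator (b j)                        ≡⟨ sum-remove {i = i} (indicator ∘ b) ⟩
  indicator (b i) + sum (removeAt (indicator ∘ b) i)    ≡⟨ cong₂ _+_ (indicator-T bi) (sum-cong-≗ off-i) ⟩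
  1 + ∑[ j < n ] 0                                      ≡⟨ cong suc (sum-replicate-zero n) ⟩
  1                                                     ∎
  where
  open ≡-Reasoning
  off-i : ∀ j → indicator (b (punchIn i j)) ≡ 0
  off-i j with b (punchIn i j) in eq
  ... | true  = ⊥-elim (punchInᵢ≢i i j (unique _ (subst T (sym eq) tt)))
  ... | false = refl

sum-indicator-minimiser : ∀ {n} (v : Fin n → ℕ) (b : Fin n → Bool) → Fin n →
  Injective _≡_ _≡_ v → (∀ i → T (b i) ⇔ (∀ j → v i ≤ v j)) →
  ∑[ i < n ] indicator (b i) ≡ 1
sum-indicator-minimiser {n} v b i v-injective b⇔minimal =
  sum-indicator-unique b i₀ (Equivalence.from (b⇔minimal i₀) i₀-minimal)
    (λ j bj → v-injective (≤-antisym (Equivalence.to (b⇔minimal j) bj i₀) (i₀-minimal j)))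
  where
  i₀ : Fin n
  i₀ = argmin v i (allFin n)
  i₀-minimal : ∀ j → v i₀ ≤ v j
  i₀-minimal j = lookup (f[argmin]≤f[xs] i (allFin n)) (∈-allFin j)

countB-map-applyUpTo : ∀ P (g f : ℕ → ℕ) n →
  countB P (map g (applyUpTo f n)) ≡ ∑[ i < n ] indicator (P (g (f (toℕ i))))
countB-map-applyUpTo P g f zero = refl
countB-map-applyUpTo P g f (suc n) with P (g (f 0))
... | true  = cong suc (countB-map-applyUpTo P g (f ∘ suc) n)
... | false = countB-map-applyUpTo P g (f ∘ suc) n

allB-applyUpTo : ∀ P (f : ℕ → ℕ) n → T (allB P (applyUpTo f n)) ⇔ (∀ i → i < n → T (P (f i)))
allB-applyUpTo P f zero = mk⇔ (λ _ _ ()) _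
allB-applyUpTo P f (suc n) = mk⇔ to from
  where
  rest = allB-applyUpTo P (f ∘ suc) n
  to : T (P (f 0) ∧ allB P (applyUpTo (f ∘ suc) n)) → ∀ i → i < suc n → T (P (f i))
  to all zero    _         = proj₁ (Equivalence.to T-∧ all)
  to all (suc i) (s≤s i<n) = Equivalence.to rest (proj₂ (Equivalence.to T-∧ all)) i i<n
  from : (∀ i → i < suc n → T (P (f i))) → T (P (f 0) ∧ allB P (applyUpTo (f ∘ suc) n))
  from all = Equivalence.from T-∧ (all 0 (s≤s z≤n) , Equivalence.from rest (λ i → all (suc i) ∘ s≤s))

findFrom-least : ∀ P s fuel t → s ≤ t → t < s + fuel →
  (∀ {k} → s ≤ k → k < t → P k ≡ false) → P t ≡ true → findFrom P s fuel ≡ t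
findFrom-least P s zero t s≤t t<s+0 _ _ = ⊥-elim (<⇒≱ t<s+0 (subst (_≤ t) (sym (+-identityʳ s)) s≤t))
findFrom-least P s (suc fuel) t s≤t t<s+fuel below Pt with m≤n⇒m<n∨m≡n s≤t
... | inj₂ refl rewrite Pt = refl
... | inj₁ s<t rewrite below ≤-refl s<t =
  findFrom-least P (suc s) fuel t s<t (subst (t <_) (+-suc s fuel) t<s+fuel) (below ∘ <⇒≤) Pt

infix 4 _≡_mod_
_≡_mod_ : ℕ → ℕ → (d : ℕ) → .{{NonZero d}} → Set
x ≡ y mod d = x % d ≡ y % d

module _ {d : ℕ} .{{_ : NonZero d}} where
  open ≡-Reasoning

  m*[n%d]%d≡m*n%d : ∀ m n → m * (n % d) % d ≡ m * n % d
  m*[n%d]%d≡m*n%d m n = begin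
    m * (n % d) % d           ≡⟨ %-distribˡ-* m (n % d) d ⟩
    m % d * (n % d % d) % d   ≡⟨ cong (λ t → m % d * t % d) (m%n%n≡m%n n d) ⟩
    m % d * (n % d) % d       ≡⟨ %-distribˡ-* m n d ⟨
    m * n % d                 ∎

  *-unitˡ-mod : ∀ x y → x ≡ 1 mod d → x * y ≡ y mod d
  *-unitˡ-mod x y x≡1 = begin
    x * y % d               ≡⟨ %-distribˡ-* x y d ⟩
    x % d * (y % d) % d     ≡⟨ cong (λ t → t * (y % d) % d) x≡1 ⟩
    1 % d * (y % d) % d     ≡⟨ %-distribˡ-* 1 y d ⟨
    1 * y % d               ≡⟨ cong (_% d) (*-identityˡ y) ⟩
    y % d                   ∎

  ^-one-mod : ∀ x e → x ≡ 1 mod d → x ^ e ≡ 1 mod d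
  ^-one-mod x zero    x≡1 = refl
  ^-one-mod x (suc e) x≡1 = trans (*-unitˡ-mod x (x ^ e) x≡1) (^-one-mod x e x≡1)

  +-cancelˡ-mod : ∀ m n → m + n ≡ m mod d → d ∣ n
  +-cancelˡ-mod m n m+n≡m = divides (q′ ∸ q) (begin
    n                                    ≡⟨ m+n∸m≡n m n ⟨
    m + n ∸ m                            ≡⟨ cong₂ _∸_ (m≡m%n+[m/n]*n (m + n) d) (m≡m%n+[m/n]*n m d) ⟩
    (m + n) % d + q′ * d ∸ (m % d + q * d) ≡⟨ cong (λ r → r + q′ * d ∸ (m % d + q * d)) m+n≡m ⟩
    m % d + q′ * d ∸ (m % d + q * d)     ≡⟨ [m+n]∸[m+o]≡n∸o (m % d) (q′ * d) (q * d) ⟩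
    q′ * d ∸ q * d                       ≡⟨ *-distribʳ-∸ d q′ q ⟨
    (q′ ∸ q) * d                         ∎)
    where
    q q′ : ℕ
    q  = m / d
    q′ = (m + n) / d

  ≡1-mod⇒∣∸1 : ∀ {x} → x ≡ 1 mod d → d ∣ x ∸ 1
  ≡1-mod⇒∣∸1 {zero}  _   = divides 0 refl
  ≡1-mod⇒∣∸1 {suc x} x≡1 = +-cancelˡ-mod 1 x x≡1

  ∣∸1⇒≡1-mod : ∀ {x} → 0 < x → d ∣ x ∸ 1 → x ≡ 1 mod d
  ∣∸1⇒≡1-mod {suc x} _ d∣x = %-remove-+ʳ 1 d∣x

¬2∣⇒%2≡1 : ∀ {n} → ¬ 2 ∣ n → n % 2 ≡ 1
¬2∣⇒%2≡1 {n} 2∤n with n % 2 in eq | m%n<n n 2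
... | 0 | _ = ⊥-elim (2∤n (m%n≡0⇒n∣m n 2 eq))
... | 1 | _ = refl
... | suc (suc _) | s≤s (s≤s ())

∣⇒nonZero : ∀ {d n} .{{_ : NonZero n}} → d ∣ n → NonZero d
∣⇒nonZero {n = n} d∣n = ≢-nonZero λ { refl → ≢-nonZero⁻¹ n (0∣⇒≡0 d∣n) }

module _ {d} .{{_ : NonZero d}} (x : ℕ) where
  open ≡-Reasoning

  bézout⇒≡1-mod : ∀ {k l} u v → 1 + v * l ≡ u * k → x ^ k ≡ 1 mod d → x ^ l ≡ 1 mod d → x ≡ 1 mod d
  bézout⇒≡1-mod {k} {l} u v 1+vl≡uk x^k≡1 x^l≡1 = begin
    x % d                      ≡⟨ *-unitˡ-mod ((x ^ l) ^ v) x (^-one-mod (x ^ l) v x^l≡1) ⟨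
    (x ^ l) ^ v * x % d        ≡⟨ cong (λ t → t * x % d) (^-*-assoc x l v) ⟩
    x ^ (l * v) * x % d        ≡⟨ cong (_% d) (*-comm (x ^ (l * v)) x) ⟩
    x ^ suc (l * v) % d        ≡⟨ cong (λ t → x ^ suc t % d) (*-comm l v) ⟩
    x ^ (1 + v * l) % d        ≡⟨ cong (λ t → x ^ t % d) 1+vl≡uk ⟩
    x ^ (u * k) % d            ≡⟨ cong (λ t → x ^ t % d) (*-comm u k) ⟩
    x ^ (k * u) % d            ≡⟨ cong (_% d) (^-*-assoc x k u) ⟨
    (x ^ k) ^ u % d            ≡⟨ ^-one-mod (x ^ k) u x^k≡1 ⟩
    1 % d                      ∎

  coprime-exponents⇒≡1-mod : ∀ {k l} → Coprime k l → x ^ k ≡ 1 mod d → x ^ l ≡ 1 mod d → x ≡ 1 mod d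
  coprime-exponents⇒≡1-mod k⊥l x^k≡1 x^l≡1 with coprime-Bézout k⊥l
  ... | Bézout.+- u v eq = bézout⇒≡1-mod u v eq x^k≡1 x^l≡1
  ... | Bézout.-+ u v eq = bézout⇒≡1-mod v u eq x^l≡1 x^k≡1


-- The modulus is written suc n because ord, isCosetMin and numCosets reduce modulo suc (m ∸ 1).
module FreeAction (a n : ℕ) where
  m : ℕ
  m = suc n

  act : ℕ → ℕ → ℕ
  act k x = a ^ k * x % m

  act-< : ∀ k x → act k x < m
  act-< k x = m%n<n (a ^ k * x) m

  act-∘ : ∀ i j x → act i (act j x) ≡ act (i + j) x
  act-∘ i j x = begin
    a ^ i * (a ^ j * x % m) % m  ≡⟨ m*[n%d]%d≡m*n%d (a ^ i) (a ^ j * x) ⟩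
    a ^ i * (a ^ j * x) % m      ≡⟨ cong (_% m) (*-assoc (a ^ i) (a ^ j) x) ⟨
    a ^ i * a ^ j * x % m        ≡⟨ cong (λ t → t * x % m) (^-distribˡ-+-* a i j) ⟨
    a ^ (i + j) * x % m          ∎
    where open ≡-Reasoning

  act-identity : ∀ {x} → x < m → act 0 x ≡ x
  act-identity {x} x<m = trans (cong (_% m) (*-identityˡ x)) (m<n⇒m%n≡m x<m)

  act-fixes-0 : ∀ k → act k 0 ≡ 0
  act-fixes-0 k = cong (_% m) (*-zeroʳ (a ^ k))

  module _ {h : ℕ} (0<h : 0 < h) (h≤m : h ≤ m) (1<m : 1 < m) (a^h≡1 : a ^ h ≡ 1 mod m)
           (free : ∀ {k x} → 0 < k → k < h → 0 < x → x < m → ¬ (a ^ k * x ≡ x mod m)) where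

    instance
      h-nonZero : NonZero h
      h-nonZero = >-nonZero 0<h

    act-period : ∀ k x → act (k + h) x ≡ act k x
    act-period k x = begin
      act (k + h) x      ≡⟨ act-∘ k h x ⟨
      act k (act h x)    ≡⟨ cong (act k) (*-unitˡ-mod (a ^ h) x a^h≡1) ⟩
      act k (x % m)      ≡⟨ m*[n%d]%d≡m*n%d (a ^ k) x ⟩
      act k x            ∎
      where open ≡-Reasoning

    act-+*h : ∀ k q x → act (k + q * h) x ≡ act k x
    act-+*h k zero    x = cong (λ t → act t x) (+-identityʳ k)
    act-+*h k (suc q) x = begin
      act (k + (h + q * h)) x  ≡⟨ cong (λ t → act (k + t) x) (+-comm h (q * h)) ⟩
      act (k + (q * h + h)) x  ≡⟨ cong (λ t → act t x) (+-assoc k (q * h) h) ⟨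
      act (k + q * h + h) x    ≡⟨ act-period (k + q * h) x ⟩
      act (k + q * h) x        ≡⟨ act-+*h k q x ⟩
      act k x                  ∎
      where open ≡-Reasoning

    act-%h : ∀ k x → act (k % h) x ≡ act k x
    act-%h k x = trans (sym (act-+*h (k % h) (k / h) x)) (cong (λ t → act t x) (sym (m≡m%n+[m/n]*n k h)))

    act-inverse : ∀ {x} i j → i + j ≡ h → x < m → act i (act j x) ≡ x
    act-inverse {x} i j i+j≡h x<m = begin
      act i (act j x)  ≡⟨ act-∘ i j x ⟩
      act (i + j) x    ≡⟨ cong (λ t → act t x) i+j≡h ⟩
      act (0 + h) x    ≡⟨ act-period 0 x ⟩
      act 0 x          ≡⟨ act-identity x<m ⟩
      x                ∎
      where open ≡-Reasoning

    ord≡h : ord a m ≡ h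
    ord≡h = findFrom-least _ 1 m h 0<h (s≤s h≤m) below (trans (isYes≗does _) (dec-true (a ^ h % m ≟ 1 % m) a^h≡1))
      where
      below : ∀ {k} → 1 ≤ k → k < h → ⌊ a ^ k % m ≟ 1 % m ⌋ ≡ false
      below {k} 0<k k<h = trans (isYes≗does _) (dec-false (a ^ k % m ≟ 1 % m) λ a^k≡1 →
        free 0<k k<h (s≤s z≤n) 1<m (trans (cong (_% m) (*-identityʳ (a ^ k))) a^k≡1))

    act-no-collision : ∀ {x} → 0 < x → x < m → ∀ {i j} → i < j → j < h → act i x ≢ act j x
    act-no-collision {x} 0<x x<m {i} {j} i<j j<h eq =
      free 0<k k<h 0<x x<m (trans act-k≡x (sym (m<n⇒m%n≡m x<m)))
      where
      k = h ∸ j + i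
      0<k : 0 < k
      0<k = ≤-trans (m<n⇒0<n∸m j<h) (m≤m+n (h ∸ j) i)
      k<h : k < h
      k<h = subst (k <_) (m∸n+n≡m (<⇒≤ j<h)) (+-monoʳ-< (h ∸ j) i<j)
      act-k≡x : act k x ≡ x
      act-k≡x = begin
        act k x                ≡⟨ act-∘ (h ∸ j) i x ⟨
        act (h ∸ j) (act i x)  ≡⟨ cong (act (h ∸ j)) eq ⟩
        act (h ∸ j) (act j x)  ≡⟨ act-inverse (h ∸ j) j (m∸n+n≡m (<⇒≤ j<h)) x<m ⟩
        x                      ∎
        where open ≡-Reasoning

    act-injective : ∀ {x} → 0 < x → x < m → ∀ {i j} → i < h → j < h → act i x ≡ act j x → i ≡ j
    act-injective 0<x x<m {i} {j} i<h j<h eq with <-cmp i j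
    ... | tri< i<j _ _ = ⊥-elim (act-no-collision 0<x x<m i<j j<h eq)
    ... | tri≈ _ i≡j _ = i≡j
    ... | tri> _ _ j<i = ⊥-elim (act-no-collision 0<x x<m j<i i<h (sym eq))

    isCosetMin⇔ : ∀ y → T (isCosetMin a m y) ⇔ (∀ i → i < h → y ≤ act i y)
    isCosetMin⇔ y = mk⇔
      (λ t i i<h → toWitness (Equivalence.to allB⇔ (subst T unfold t) i i<h))
      (λ y-min → subst T (sym unfold) (Equivalence.from allB⇔ (λ i i<h → fromWitness (y-min i i<h))))
      where
      P : ℕ → Bool
      P i = ⌊ y ≤? act i y ⌋
      unfold : isCosetMin a m y ≡ allB P (upTo h)
      unfold = cong (λ o → allB P (upTo o)) ord≡h
      allB⇔ = allB-applyUpTo P (λ i → i) h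

    isCosetMin-act⇔ : ∀ {x} → x < m → (j : Fin h) →
      T (isCosetMin a m (act (toℕ j) x)) ⇔ (∀ (k : Fin h) → act (toℕ j) x ≤ act (toℕ k) x)
    isCosetMin-act⇔ {x} x<m j = mk⇔
      (λ t k → subst (act (toℕ j) x ≤_) (reaches k) (Equivalence.to (isCosetMin⇔ _) t _ (m%n<n _ h)))
      (λ min → Equivalence.from (isCosetMin⇔ _) λ i i<h →
        subst (act (toℕ j) x ≤_) (sym (lands i)) (min (fromℕ< (m%n<n (i + toℕ j) h))))
      where
      open ≡-Reasoning
      j≤h = <⇒≤ (toℕ<n j)
      reaches : ∀ k → act ((toℕ k + (h ∸ toℕ j)) % h) (act (toℕ j) x) ≡ act (toℕ k) x
      reaches k = begin
        act ((toℕ k + (h ∸ toℕ j)) % h) (act (toℕ j) x)  ≡⟨ act-%h (toℕ k + (h ∸ toℕ j)) (act (toℕ j) x) ⟩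
        act (toℕ k + (h ∸ toℕ j)) (act (toℕ j) x)        ≡⟨ act-∘ (toℕ k) (h ∸ toℕ j) _ ⟨
        act (toℕ k) (act (h ∸ toℕ j) (act (toℕ j) x))    ≡⟨ cong (act (toℕ k)) (act-inverse (h ∸ toℕ j) (toℕ j) (m∸n+n≡m j≤h) x<m) ⟩
        act (toℕ k) x                                    ∎
      lands : ∀ i → act i (act (toℕ j) x) ≡ act (toℕ (fromℕ< (m%n<n (i + toℕ j) h))) x
      lands i = begin
        act i (act (toℕ j) x)                            ≡⟨ act-∘ i (toℕ j) x ⟩
        act (i + toℕ j) x                                ≡⟨ act-%h (i + toℕ j) x ⟨
        act ((i + toℕ j) % h) x                          ≡⟨ cong (λ t → act t x) (toℕ-fromℕ< (m%n<n (i + toℕ j) h)) ⟨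
        act (toℕ (fromℕ< (m%n<n (i + toℕ j) h))) x      ∎

    orbit-has-one-cosetMin : ∀ {x} → 0 < x → x < m →
      ∑[ j < h ] indicator (isCosetMin a m (act (toℕ j) x)) ≡ 1
    orbit-has-one-cosetMin 0<x x<m = sum-indicator-minimiser _ _ (fromℕ< 0<h)
      (λ eq → toℕ-injective (act-injective 0<x x<m (toℕ<n _) (toℕ<n _) eq))
      (isCosetMin-act⇔ x<m)

    sum-act : ∀ (f : ℕ → ℕ) {j} → j ≤ h → ∑[ x < m ] f (act j (toℕ x)) ≡ ∑[ x < m ] f (toℕ x)
    sum-act f {j} j≤h = begin
      ∑[ x < m ] f (act j (toℕ x))       ≡⟨ sum-cong-≗ (λ x → cong f (toℕ-actFin j x)) ⟨
      ∑[ x < m ] f (toℕ (π ⟨$⟩ʳ x))      ≡⟨ ∑-permute (f ∘ toℕ) π ⟨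
      ∑[ x < m ] f (toℕ x)               ∎
      where
      open ≡-Reasoning
      actFin : ℕ → Fin m → Fin m
      actFin k x = fromℕ< (act-< k (toℕ x))
      toℕ-actFin : ∀ k x → toℕ (actFin k x) ≡ act k (toℕ x)
      toℕ-actFin k x = toℕ-fromℕ< (act-< k (toℕ x))
      actFin-inverse : ∀ k l → k + l ≡ h → ∀ x → actFin k (actFin l x) ≡ x
      actFin-inverse k l k+l≡h x = toℕ-injective (begin
        toℕ (actFin k (actFin l x))  ≡⟨ toℕ-actFin k (actFin l x) ⟩
        act k (toℕ (actFin l x))     ≡⟨ cong (act k) (toℕ-actFin l x) ⟩
        act k (act l (toℕ x))        ≡⟨ act-inverse k l k+l≡h (toℕ<n x) ⟩
        toℕ x                        ∎)
      π : Permutation m m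
      π = permutation (actFin j) (actFin (h ∸ j))
        (actFin-inverse j (h ∸ j) (m+[n∸m]≡n j≤h)) (actFin-inverse (h ∸ j) j (m∸n+n≡m j≤h))

    -- Count the pairs (k, x) ∈ [0, h) × [0, m) for which act k x is a coset minimum.  Each row
    -- permutes the residues, so contains the r + 1 minima (0 is one); column 0 contributes h
    -- and every other column exactly one.
    numCosets*h≡n : numCosets a m * h ≡ n
    numCosets*h≡n = begin
      numCosets a m * h  ≡⟨ *-comm (numCosets a m) h ⟩
      h * r              ≡⟨ +-cancelˡ-≡ h (h * r) n (begin
        h + h * r                               ≡⟨ *-suc h r ⟨
        h * suc r                               ≡⟨ rows ⟨
        ∑[ k < h ] ∑[ x < m ] χ (toℕ k) (toℕ x) ≡⟨ ∑-comm {h} {m} (λ k x → χ (toℕ k) (toℕ x)) ⟩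
        ∑[ x < m ] ∑[ k < h ] χ (toℕ k) (toℕ x) ≡⟨ columns ⟩
        h + n                                   ∎) ⟩
      n                  ∎
      where
      open ≡-Reasoning
      c = isCosetMin a m
      r = numCosets a m
      χ : ℕ → ℕ → ℕ
      χ k x = indicator (c (act k x))
      c[0] : indicator (c 0) ≡ 1
      c[0] = indicator-T (Equivalence.from (isCosetMin⇔ 0) (λ _ _ → z≤n))
      cosetMins : ∑[ x < m ] indicator (c (toℕ x)) ≡ suc r
      cosetMins = cong₂ _+_ c[0] (sym (countB-map-applyUpTo c suc (λ i → i) n))
      rows : ∑[ k < h ] ∑[ x < m ] χ (toℕ k) (toℕ x) ≡ h * suc r
      rows = ∑-const h (λ k → trans (sum-act (indicator ∘ c) (<⇒≤ (toℕ<n k))) cosetMins)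
      columns : ∑[ x < m ] ∑[ k < h ] χ (toℕ k) (toℕ x) ≡ h + n
      columns = cong₂ _+_
        (trans (∑-const h (λ k → trans (cong (indicator ∘ c) (act-fixes-0 (toℕ k))) c[0])) (*-identityʳ h))
        (trans (∑-const n (λ y → orbit-has-one-cosetMin (s≤s z≤n) (s≤s (toℕ<n y)))) (*-identityʳ n))

    coset-equation : m ≡ numCosets a m * ord a m + 1
    coset-equation = begin
      suc n                           ≡⟨ cong suc numCosets*h≡n ⟨
      suc (numCosets a m * h)         ≡⟨ +-comm 1 _ ⟩
      numCosets a m * h + 1           ≡⟨ cong (λ o → numCosets a m * o + 1) ord≡h ⟨
      numCosets a m * ord a m + 1     ∎
      where open ≡-Reasoning

repunit : ℕ → ℕ → ℕ
repunit a zero    = 0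
repunit a (suc k) = 1 + a * repunit a k

[1+c]^k≡1+c*repunit : ∀ c k → suc c ^ k ≡ 1 + c * repunit (suc c) k
[1+c]^k≡1+c*repunit c zero    = cong suc (sym (*-zeroʳ c))
[1+c]^k≡1+c*repunit c (suc k) = begin
  suc c * suc c ^ k                 ≡⟨ cong (suc c *_) ([1+c]^k≡1+c*repunit c k) ⟩
  suc c * (1 + c * R)               ≡⟨ solve 2 (λ c R → (con 1 :+ c) :* (con 1 :+ c :* R)
                                                   := con 1 :+ c :* (con 1 :+ (con 1 :+ c) :* R)) refl c R ⟩
  1 + c * (1 + suc c * R)           ∎
  where
  open ≡-Reasoning
  open +-*-Solver
  R = repunit (suc c) k

k≤repunit : ∀ c k → k ≤ repunit (suc c) k
k≤repunit c zero    = z≤n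
k≤repunit c (suc k) = s≤s (≤-trans (k≤repunit c k) (m≤m+n _ _))

repunit-coprime : ∀ a {k} → 0 < k → Coprime (repunit a k) a
repunit-coprime a {suc k} _ {d} (d∣1+aR , d∣a) =
  ∣1⇒≡1 (∣m+n∣m⇒∣n (subst (d ∣_) (+-comm 1 (a * repunit a k)) d∣1+aR) (∣m⇒∣m*n (repunit a k) d∣a))

M≡repunit : ∀ b p → M (2 + b) p ≡ repunit (2 + b) p
M≡repunit b p = begin
  (suc (suc b) ^ p ∸ 1) / suc b   ≡⟨ cong (λ t → (t ∸ 1) / suc b) ([1+c]^k≡1+c*repunit (suc b) p) ⟩
  suc b * R / suc b               ≡⟨ cong (_/ suc b) (*-comm (suc b) R) ⟩
  R * suc b / suc b               ≡⟨ m*n/n≡m R (suc b) ⟩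
  R                               ∎
  where
  open ≡-Reasoning
  R = repunit (2 + b) p

module PrimeRepunit (c p : ℕ) (p-prime : Prime p) (m⊥c : Coprime (repunit (suc c) p) c) where
  a m : ℕ
  a = suc c
  m = repunit a p

  0<p : 0 < p
  0<p = >-nonZero⁻¹ p {{prime⇒nonZero p-prime}}

  instance
    m-nonZero : NonZero m
    m-nonZero = >-nonZero (≤-trans 0<p (k≤repunit c p))

  a^p≡1-mod : ∀ {d} .{{_ : NonZero d}} → d ∣ m → a ^ p ≡ 1 mod d
  a^p≡1-mod {d} d∣m = trans (cong (_% d) ([1+c]^k≡1+c*repunit c p)) (%-remove-+ʳ 1 (∣n⇒∣m*n c d∣m))

  m⊥a : Coprime m a
  m⊥a = repunit-coprime a 0<p

  m⊥a^k∸1 : ∀ {k} → 0 < k → k < p → Coprime m (a ^ k ∸ 1)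
  m⊥a^k∸1 {k} 0<k k<p {d} (d∣m , d∣a^k∸1) = m⊥c (d∣m , ≡1-mod⇒∣∸1 a≡1)
    where
    instance
      d-nonZero : NonZero d
      d-nonZero = ∣⇒nonZero d∣m
    a≡1 : a ≡ 1 mod d
    a≡1 = coprime-exponents⇒≡1-mod a (prime⇒coprime p-prime {{>-nonZero 0<k}} k<p)
      (a^p≡1-mod d∣m) (∣∸1⇒≡1-mod (m^n>0 a k) d∣a^k∸1)

  a^k*x≢x-mod : ∀ {k x} → 0 < k → k < p → 0 < x → x < m → ¬ (a ^ k * x ≡ x mod m)
  a^k*x≢x-mod {k} {x@(suc _)} 0<k k<p _ x<m a^kx≡x = <⇒≱ x<m (∣⇒≤ m∣x)
    where
    x+[a^k∸1]x≡a^kx : x + (a ^ k ∸ 1) * x ≡ a ^ k * x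
    x+[a^k∸1]x≡a^kx = cong (_* x) (m+[n∸m]≡n (m^n>0 a k))
    m∣x : m ∣ x
    m∣x = coprime-divisor (m⊥a^k∸1 0<k k<p)
      (+-cancelˡ-mod x _ (trans (cong (_% m) x+[a^k∸1]x≡a^kx) a^kx≡x))

  m-odd : m % 2 ≡ 1
  m-odd = ¬2∣⇒%2≡1 2∤m
    where
    2∤m : ¬ 2 ∣ m
    2∤m 2∣m with 2 ∣? a
    ... | yes 2∣a = contradiction (m⊥a (2∣m , 2∣a)) λ ()
    ... | no 2∤a  = contradiction (m⊥c (2∣m , ≡1-mod⇒∣∸1 {x = a} (¬2∣⇒%2≡1 2∤a))) λ ()

repunit-prime⊎overpseudoprime : ∀ b q → Prime (2 + q) → Coprime (repunit (2 + b) (2 + q)) (suc b) →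
  Prime (repunit (2 + b) (2 + q)) ⊎ Overpseudoprime (2 + b) (repunit (2 + b) (2 + q))
repunit-prime⊎overpseudoprime b q p-prime m⊥c with prime? (repunit (2 + b) (2 + q))
... | yes m-prime = inj₁ m-prime
... | no ¬m-prime = inj₂ (m-odd , ¬prime⇒composite ¬m-prime , m⊥a ,
        coset-equation (s≤s z≤n) (k≤repunit (suc b) (2 + q)) (s≤s (s≤s z≤n)) (a^p≡1-mod ∣-refl) a^k*x≢x-mod)
  where
  open PrimeRepunit (suc b) (2 + q) p-prime m⊥c
  open FreeAction a (a * repunit a (suc q))

theorem9 : (a p : ℕ) → 1 < a → Prime p → Coprime (M a p) (a ∸ 1) →
    Prime (M a p) ⊎ Overpseudoprime a (M a p)
theorem9 (suc (suc b)) (suc (suc q)) _ p-prime M⊥a∸1 =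
  subst (λ m → Prime m ⊎ Overpseudoprime (2 + b) m) (sym M≡R)
    (repunit-prime⊎overpseudoprime b q p-prime (subst (λ m → Coprime m (suc b)) M≡R M⊥a∸1))
  where M≡R = M≡repunit b (2 + q)
theorem9 _ 0       _ p-prime _ = ⊥-elim (¬prime[0] p-prime)
theorem9 _ 1       _ p-prime _ = ⊥-elim (¬prime[1] p-prime)
theorem9 0 (suc (suc _)) () _ _
theorem9 1 (suc (suc _)) (s≤s ()) _ _
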